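{- Let $G$ be a simple, $3$-edge-connected graph with $\operatorname{gon}(G)=3$, and let $D$ be a divisor on $G$ with $r(D)=1$ and $\deg(D)=3$. Then for every vertex $v\in V(G)$ there exists a unique effective divisor $D'$ with $D'\sim D$ and $v\in\mathrm{supp}(D')$.
   Context: A graph is finite, connected, loopless; simple means no multiple edges. $3$-edge-connected means deleting any $2$ edges leaves the graph connected. A divisor is an integer combination $\sum_v D(v)(v)$ of vertices; it is effective if all coefficients are $\ge0$, and $\mathrm{supp}(D)=\{v:D(v)>0\}$. $D\sim D'$ if $D-D'$ is in the image of the Laplacian ($\Delta_{v,v}=\mathrm{val}(v)$, $\Delta_{v,w}=-$number of edges between $v,w$). The rank $r(D)$ is $-1$ if no effective divisor is equivalent to $D$, and otherwise the largest $k$ such that for every effective divisor $F$ of degree $k$ some effective divisor is equivalent to $D-F$. $\operatorname{gon}(G)$ is the minimum degree of an effective divisor of rank $\ge1$. -}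

module Defs where

open import Data.Nat as ℕ using (ℕ; zero; suc)
open import Data.Integer as ℤ using (ℤ; +_; _-_; _*_; _+_; _<_; _≤_)
open import Data.Fin using (Fin; _≟_)
open import Data.List.Membership.Propositional using (_∈_)
open import Data.List using (List; []; _∷_; length; removeAt)
open import Data.Product using (Σ; _×_; _,_; proj₁; proj₂; ∃)
open import Data.Sum using (_⊎_)
open import Relation.Nullary using (¬_; yes; no)
open import Relation.Binary.PropositionalEquality using (_≡_; _≢_)

-- A (finite, loopless, multi-)graph on vertex set Fin n, given by its list of edges.
-- Each edge is a pair of endpoints; multiple edges are repeated list entries.
Edges : ℕ → Set
Edges n = List (Fin n × Fin n)

Loopless : ∀ {n} → Edges n → Set
Loopless {n} E = ∀ (e : Fin n × Fin n) → e ∈ E → proj₁ e ≢ proj₂ e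

mult : ∀ {n} → Edges n → Fin n → Fin n → ℕ
mult [] v w = 0
mult ((a , b) ∷ E) v w with a ≟ v | b ≟ w | a ≟ w | b ≟ v
... | yes _ | yes _ | _ | _ = suc (mult E v w)
... | _ | _ | yes _ | yes _ = suc (mult E v w)
... | _ | _ | _ | _ = mult E v w

val : ∀ {n} → Edges n → Fin n → ℕ
val [] v = 0
val ((a , b) ∷ E) v with a ≟ v | b ≟ v
... | yes _ | _ = suc (val E v)
... | _ | yes _ = suc (val E v)
... | no _ | no _ = val E v

Simple : ∀ {n} → Edges n → Set
Simple {n} E = ∀ (v w : Fin n) → mult E v w ℕ.≤ 1

Adjacent : ∀ {n} → Edges n → Fin n → Fin n → Set
Adjacent E v w = 0 ℕ.< mult E v w

data Reachable {n} (E : Edges n) : Fin n → Fin n → Set where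
  here : ∀ {v} → Reachable E v v
  step : ∀ {u v w} → Adjacent E u v → Reachable E v w → Reachable E u w

Connected : ∀ {n} → Edges n → Set
Connected {n} E = ∀ (u v : Fin n) → Reachable E u v

ThreeEdgeConnected : ∀ {n} → Edges n → Set
ThreeEdgeConnected E =
  Connected E
  × (∀ i → Connected (removeAt E i))
  × (∀ i j → Connected (removeAt (removeAt E i) j))

ΣFin : ∀ n → (Fin n → ℤ) → ℤ
ΣFin zero f = + 0
ΣFin (suc n) f = f Fin.zero + ΣFin n (λ i → f (Fin.suc i))

Divisor : ℕ → Set
Divisor n = Fin n → ℤ

deg : ∀ {n} → Divisor n → ℤ
deg {n} D = ΣFin n D

Effective : ∀ {n} → Divisor n → Set
Effective D = ∀ v → + 0 ≤ D v

_-D_ : ∀ {n} → Divisor n → Divisor n → Divisor n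
(D -D F) v = D v - F v

Lap : ∀ {n} → Edges n → Fin n → Fin n → ℤ
Lap E v w with v ≟ w
... | yes _ = + val E v
... | no _ = ℤ.- (+ mult E v w)

LapApply : ∀ {n} → Edges n → (Fin n → ℤ) → Divisor n
LapApply {n} E f v = ΣFin n (λ w → Lap E v w * f w)

_∼[_]_ : ∀ {n} → Divisor n → Edges n → Divisor n → Set
_∼[_]_ {n} D E D' = Σ (Fin n → ℤ) λ f → ∀ v → D v - D' v ≡ LapApply E f v

RankProp : ∀ {n} → Edges n → ℕ → Divisor n → Set
RankProp {n} E k D =
  ∀ (F : Divisor n) → Effective F → deg F ≡ + k →
    Σ (Divisor n) λ D' → Effective D' × (D' ∼[ E ] (D -D F))

RankEq : ∀ {n} → Edges n → Divisor n → ℕ → Set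
RankEq E D k = RankProp E k D × (∀ m → k ℕ.< m → ¬ RankProp E m D)

RankGE1 : ∀ {n} → Edges n → Divisor n → Set
RankGE1 E D = RankProp E 1 D

GonEq : ∀ {n} → Edges n → ℕ → Set
GonEq {n} E g =
  (Σ (Divisor n) λ D → Effective D × RankGE1 E D × deg D ≡ + g)
  × (∀ (D : Divisor n) → Effective D → RankGE1 E D → + g ≤ deg D)

module Submission where

-- Existence: r(D) ≥ 1 applied to F = (v) yields an effective D₀ ∼ D - (v), and
-- D' = D₀ + (v) is effective, equivalent to D and contains v.  Uniqueness: any other such D''
-- is equivalent to D' and of degree 3; removing v from both leaves equivalent effective
-- divisors of degree 2, and these coincide by the rigidity lemma `rigid`: on a loopless
-- 3-edge-connected graph two equivalent effective divisors A, B with deg A ≤ 2 are equal.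
-- For rigidity write A - B = Δ f and let P be the set where f is maximal; summation by parts
--     #(edges leaving P) ≤ Σ_{x ∈ P} (Δ f)(x) = Σ_{x ∈ P} (A x - B x) ≤ deg A ≤ 2,
-- so 3-edge-connectivity forces P to be all of G, f is constant and A = B.

open import Defs
open import Data.Nat using (ℕ)
open import Data.Integer using (ℤ; +_; _<_)
open import Data.Fin using (Fin)
open import Data.Product using (Σ; _×_)
open import Relation.Binary.PropositionalEquality using (_≡_)

open import Data.Bool using (true; false; if_then_else_)
open import Data.Nat as ℕ using (zero; suc)
import Data.Nat.Properties as ℕₚ
open import Data.Integer using (_+_; _-_; _*_; -_; _≤_; 0ℤ; 1ℤ; -1ℤ)
import Data.Integer as ℤ
import Data.Integer.Properties as ℤₚ
open import Data.Integer.Tactic.RingSolver using (solve-∀)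
open import Data.Fin as Fin using (_≟_)
open import Data.List using ([]; _∷_; length; removeAt; allFin)
open import Data.List.Relation.Unary.Any using (here; there)
open import Data.List.Membership.Propositional using (_∈_)
open import Data.Product using (_,_; proj₁; proj₂)
open import Data.Sum using (_⊎_; inj₁; inj₂)
open import Data.Empty using (⊥-elim)
open import Function using (_∘_)
open import Data.List.Extrema ℤₚ.≤-totalOrder using (argmax; f[xs]≤f[argmax])
import Data.List.Relation.Unary.All as All
open import Data.List.Membership.Propositional.Properties using (∈-allFin)
open import Relation.Nullary using (Dec; yes; no; does)
open import Relation.Nullary.Decidable using (dec-true)
open import Relation.Binary.PropositionalEquality
  using (refl; sym; trans; cong; cong₂; subst; _≢_; module ≡-Reasoning)

_+D_ : ∀ {n} → Divisor n → Divisor n → Divisor n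
(A +D B) x = A x + B x

δ : ∀ {n} → Fin n → Divisor n
δ a x = if does (a ≟ x) then 1ℤ else 0ℤ

δ-diag : ∀ {n} (a : Fin n) → δ a a ≡ 1ℤ
δ-diag a rewrite dec-true (a ≟ a) refl = refl

δ-effective : ∀ {n} (a : Fin n) → Effective (δ a)
δ-effective a x with does (a ≟ x)
... | true = ℤ.+≤+ ℕ.z≤n
... | false = ℤₚ.≤-refl

add-point : ∀ {n} {D : Divisor n} → Effective D → ∀ v → + 0 < (D +D δ v) v
add-point {D = D} effD v rewrite δ-diag v = ℤₚ.suc[i]≤j⇒i<j (ℤₚ.+-monoˡ-≤ 1ℤ (effD v))

remove-point : ∀ {n} {D : Divisor n} → Effective D → ∀ {v} → + 0 < D v → Effective (D -D δ v)
remove-point {D = D} effD {v} 0<Dv w with v ≟ w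
... | yes refl = ℤₚ.i≤j⇒0≤j-i (ℤₚ.i<j⇒suc[i]≤j 0<Dv)
... | no _ = ℤₚ.≤-trans (effD w) (ℤₚ.≤-reflexive (sym (ℤₚ.+-identityʳ (D w))))

Σ-cong : ∀ n {f g : Fin n → ℤ} → (∀ i → f i ≡ g i) → ΣFin n f ≡ ΣFin n g
Σ-cong zero eq = refl
Σ-cong (suc n) eq = cong₂ _+_ (eq Fin.zero) (Σ-cong n (λ i → eq (Fin.suc i)))

Σ-+ : ∀ n (f g : Fin n → ℤ) → ΣFin n (λ i → f i + g i) ≡ ΣFin n f + ΣFin n g
Σ-+ zero f g = refl
Σ-+ (suc n) f g =
  trans (cong (λ t → (f Fin.zero + g Fin.zero) + t) (Σ-+ n (f ∘ Fin.suc) (g ∘ Fin.suc)))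
        (interchange (f Fin.zero) (g Fin.zero) _ _)
  where
  interchange : ∀ (a b c d : ℤ) → (a + b) + (c + d) ≡ (a + c) + (b + d)
  interchange = solve-∀

Σ-- : ∀ n (f g : Fin n → ℤ) → ΣFin n (λ i → f i - g i) ≡ ΣFin n f - ΣFin n g
Σ-- zero f g = refl
Σ-- (suc n) f g =
  trans (cong (λ t → (f Fin.zero - g Fin.zero) + t) (Σ-- n (f ∘ Fin.suc) (g ∘ Fin.suc)))
        (interchange (f Fin.zero) (g Fin.zero) _ _)
  where
  interchange : ∀ (a b c d : ℤ) → (a - b) + (c - d) ≡ (a + c) - (b + d)
  interchange = solve-∀

Σ-*ˡ : ∀ n (c : ℤ) (f : Fin n → ℤ) → ΣFin n (λ i → c * f i) ≡ c * ΣFin n f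
Σ-*ˡ zero c f = sym (ℤₚ.*-zeroʳ c)
Σ-*ˡ (suc n) c f =
  trans (cong (λ t → c * f Fin.zero + t) (Σ-*ˡ n c (f ∘ Fin.suc))) (sym (ℤₚ.*-distribˡ-+ c _ _))

Σ-zero : ∀ n → ΣFin n (λ _ → 0ℤ) ≡ 0ℤ
Σ-zero zero = refl
Σ-zero (suc n) = trans (ℤₚ.+-identityˡ _) (Σ-zero n)

Σ-mono : ∀ n {f g : Fin n → ℤ} → (∀ i → f i ≤ g i) → ΣFin n f ≤ ΣFin n g
Σ-mono zero le = ℤₚ.≤-refl
Σ-mono (suc n) le = ℤₚ.+-mono-≤ (le Fin.zero) (Σ-mono n (λ i → le (Fin.suc i)))

Σ-δ : ∀ n (a : Fin n) (g : Fin n → ℤ) → ΣFin n (λ x → δ a x * g x) ≡ g a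
Σ-δ (suc n) Fin.zero g = begin
  1ℤ * g Fin.zero + ΣFin n (λ _ → 0ℤ) ≡⟨ cong₂ _+_ (ℤₚ.*-identityˡ (g Fin.zero)) (Σ-zero n) ⟩
  g Fin.zero + 0ℤ                     ≡⟨ ℤₚ.+-identityʳ _ ⟩
  g Fin.zero                          ∎
  where open ≡-Reasoning
Σ-δ (suc n) (Fin.suc a) g = trans (ℤₚ.+-identityˡ _) (Σ-δ n a (g ∘ Fin.suc))

deg-δ : ∀ {n} (a : Fin n) → deg (δ a) ≡ 1ℤ
deg-δ {n} a = trans (Σ-cong n (λ x → sym (ℤₚ.*-identityʳ (δ a x)))) (Σ-δ n a (λ _ → 1ℤ))

deg-minus-point : ∀ {n} (D : Divisor n) (v : Fin n) → deg (D -D δ v) ≡ deg D - 1ℤ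
deg-minus-point {n} D v = trans (Σ-- n D (δ v)) (cong (λ t → deg D - t) (deg-δ v))

inc : ∀ {n} → Fin n → Fin n → Fin n → ℤ
inc a b x = δ a x - δ b x

Σ-inc : ∀ n (a b : Fin n) (g : Fin n → ℤ) → ΣFin n (λ x → inc a b x * g x) ≡ g a - g b
Σ-inc n a b g = begin
  ΣFin n (λ x → inc a b x * g x)                           ≡⟨ Σ-cong n (λ x → distrib (δ a x) (δ b x) (g x)) ⟩
  ΣFin n (λ x → δ a x * g x - δ b x * g x)                 ≡⟨ Σ-- n _ _ ⟩
  ΣFin n (λ x → δ a x * g x) - ΣFin n (λ x → δ b x * g x)  ≡⟨ cong₂ _-_ (Σ-δ n a g) (Σ-δ n b g) ⟩
  g a - g b                                                ∎
  where
  open ≡-Reasoning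
  distrib : ∀ (p q r : ℤ) → (p - q) * r ≡ p * r - q * r
  distrib = solve-∀

edgeLap : ∀ {n} → Edges n → (Fin n → ℤ) → Divisor n
edgeLap [] h x = 0ℤ
edgeLap ((a , b) ∷ E) h x = inc a b x * (h a - h b) + edgeLap E h x

-- Adding a non-loop edge (a , b) adds the rank-one matrix inc a b ⊗ inc a b to the Laplacian:
-- first on the diagonal (valences) ...
val-cons : ∀ {n} (E : Edges n) {a b : Fin n} → a ≢ b → ∀ u →
  + val ((a , b) ∷ E) u ≡ inc a b u * inc a b u + + val E u
val-cons E {a} {b} a≢b u with a ≟ u | b ≟ u
... | yes refl | yes refl = ⊥-elim (a≢b refl)
... | yes refl | no _ = refl
... | no _ | yes refl = refl
... | no _ | no _ = refl

-- ... and then off the diagonal (edge multiplicities).  For x ≢ z the product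
-- inc a b x · inc a b z is -1 exactly when the edge joins x and z, and 0 otherwise.
mult-cons : ∀ {n} (E : Edges n) {a b : Fin n} → a ≢ b → ∀ {x z} → x ≢ z →
  - (+ mult ((a , b) ∷ E) x z) ≡ inc a b x * inc a b z + - (+ mult E x z)
mult-cons E {a} {b} a≢b {x} {z} x≢z with a ≟ x | b ≟ z | a ≟ z | b ≟ x
... | yes refl | yes refl | yes refl | _        = ⊥-elim (x≢z refl)
... | yes refl | yes refl | no _     | yes refl = ⊥-elim (a≢b refl)
... | yes refl | yes refl | no _     | no _     = ℤₚ.neg-distrib-+ 1ℤ (+ mult E a b)
... | yes refl | no _     | yes refl | _        = ⊥-elim (x≢z refl)
... | yes refl | no _     | no _     | yes refl = ⊥-elim (a≢b refl)
... | yes refl | no _     | no _     | no _     = sym (ℤₚ.+-identityˡ _)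
... | no _     | yes refl | yes refl | _        = ⊥-elim (a≢b refl)
... | no _     | yes refl | no _     | yes refl = ⊥-elim (x≢z refl)
... | no _     | yes refl | no _     | no _     = sym (ℤₚ.+-identityˡ _)
... | no _     | no _     | yes refl | yes refl = ℤₚ.neg-distrib-+ 1ℤ (+ mult E b a)
... | no _     | no _     | yes refl | no _     = sym (ℤₚ.+-identityˡ _)
... | no _     | no _     | no _     | yes refl = sym (ℤₚ.+-identityˡ _)
... | no _     | no _     | no _     | no _     = sym (ℤₚ.+-identityˡ _)

Lap-cons : ∀ {n} (E : Edges n) {a b : Fin n} → a ≢ b → ∀ u x →
  Lap ((a , b) ∷ E) u x ≡ inc a b u * inc a b x + Lap E u x
Lap-cons E a≢b u x with u ≟ x
... | yes refl = val-cons E a≢b u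
... | no u≢x = mult-cons E a≢b u≢x

Lap-[] : ∀ {n} (u x : Fin n) → Lap [] u x ≡ 0ℤ
Lap-[] u x with u ≟ x
... | yes _ = refl
... | no _ = refl

LapApply≡edgeLap : ∀ {n} {E : Edges n} → Loopless E → ∀ h x → LapApply E h x ≡ edgeLap E h x
LapApply≡edgeLap {n} {[]} _ h x = trans (Σ-cong n (λ y → cong (_* h y) (Lap-[] x y))) (Σ-zero n)
LapApply≡edgeLap {n} {(a , b) ∷ E} loopless h x = begin
  ΣFin n (λ y → Lap ((a , b) ∷ E) x y * h y)
    ≡⟨ Σ-cong n (λ y → trans (cong (_* h y) (Lap-cons E a≢b x y)) (expand (inc a b x) _ _ (h y))) ⟩
  ΣFin n (λ y → inc a b x * (inc a b y * h y) + Lap E x y * h y)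
    ≡⟨ Σ-+ n _ _ ⟩
  ΣFin n (λ y → inc a b x * (inc a b y * h y)) + LapApply E h x
    ≡⟨ cong₂ _+_ (trans (Σ-*ˡ n (inc a b x) _) (cong (inc a b x *_) (Σ-inc n a b h)))
                 (LapApply≡edgeLap (λ e e∈E → loopless e (there e∈E)) h x) ⟩
  inc a b x * (h a - h b) + edgeLap E h x
    ∎
  where
  open ≡-Reasoning
  a≢b : a ≢ b
  a≢b = loopless (a , b) (here refl)
  expand : ∀ (p q l r : ℤ) → (p * q + l) * r ≡ p * (q * r) + l * r
  expand = solve-∀

energy : ∀ {n} → Edges n → (Fin n → ℤ) → (Fin n → ℤ) → ℤ
energy [] w h = 0ℤ
energy ((a , b) ∷ E) w h = (w a - w b) * (h a - h b) + energy E w h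

summation-by-parts : ∀ {n} (E : Edges n) (w h : Fin n → ℤ) →
  ΣFin n (λ x → w x * edgeLap E h x) ≡ energy E w h
summation-by-parts {n} [] w h = trans (Σ-cong n (λ x → ℤₚ.*-zeroʳ (w x))) (Σ-zero n)
summation-by-parts {n} ((a , b) ∷ E) w h = begin
  ΣFin n (λ x → w x * (inc a b x * c + edgeLap E h x))
    ≡⟨ Σ-cong n (λ x → expand (w x) (inc a b x) c (edgeLap E h x)) ⟩
  ΣFin n (λ x → inc a b x * (w x * c) + w x * edgeLap E h x)
    ≡⟨ Σ-+ n _ _ ⟩
  ΣFin n (λ x → inc a b x * (w x * c)) + ΣFin n (λ x → w x * edgeLap E h x)
    ≡⟨ cong₂ _+_ (Σ-inc n a b (λ x → w x * c)) (summation-by-parts E w h) ⟩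
  (w a * c - w b * c) + energy E w h
    ≡⟨ cong (_+ energy E w h) (factor (w a) (w b) c) ⟩
  (w a - w b) * c + energy E w h
    ∎
  where
  open ≡-Reasoning
  c : ℤ
  c = h a - h b
  expand : ∀ (p q r s : ℤ) → p * (q * r + s) ≡ q * (p * r) + p * s
  expand = solve-∀
  factor : ∀ (p q r : ℤ) → p * r - q * r ≡ (p - q) * r
  factor = solve-∀

energy-const : ∀ {n} (E : Edges n) (c : ℤ) (h : Fin n → ℤ) → energy E (λ _ → c) h ≡ 0ℤ
energy-const [] c h = refl
energy-const ((a , b) ∷ E) c h =
  trans (cong (λ t → (c - c) * (h a - h b) + t) (energy-const E c h)) (vanish c (h a - h b))
  where
  vanish : ∀ (c d : ℤ) → (c - c) * d + 0ℤ ≡ 0ℤ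
  vanish = solve-∀

edgeLap-const : ∀ {n} (E : Edges n) {h : Fin n → ℤ} {c : ℤ} → (∀ x → h x ≡ c) → ∀ x → edgeLap E h x ≡ 0ℤ
edgeLap-const [] const x = refl
edgeLap-const ((a , b) ∷ E) {h} {c} const x
  rewrite const a | const b | edgeLap-const E const x = vanish (inc a b x) c
  where
  vanish : ∀ (i c : ℤ) → i * (c - c) + 0ℤ ≡ 0ℤ
  vanish = solve-∀

deg-principal : ∀ {n} {E : Edges n} → Loopless E → ∀ f → deg (LapApply E f) ≡ 0ℤ
deg-principal {n} {E} loopless f = begin
  ΣFin n (LapApply E f)                   ≡⟨ Σ-cong n (λ x → trans (LapApply≡edgeLap loopless f x)
                                                                (sym (ℤₚ.*-identityˡ _))) ⟩
  ΣFin n (λ x → 1ℤ * edgeLap E f x)       ≡⟨ summation-by-parts E (λ _ → 1ℤ) f ⟩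
  energy E (λ _ → 1ℤ) f                   ≡⟨ energy-const E 1ℤ f ⟩
  0ℤ                                      ∎
  where open ≡-Reasoning

LapApply-- : ∀ {n} (E : Edges n) (f g : Fin n → ℤ) x →
  LapApply E (λ y → f y - g y) x ≡ LapApply E f x - LapApply E g x
LapApply-- {n} E f g x =
  trans (Σ-cong n (λ y → distrib (Lap E x y) (f y) (g y))) (Σ-- n _ _)
  where
  distrib : ∀ (l p q : ℤ) → l * (p - q) ≡ l * p - l * q
  distrib = solve-∀

∼-common : ∀ {n} {E : Edges n} {A B C : Divisor n} → A ∼[ E ] C → B ∼[ E ] C → A ∼[ E ] B
∼-common {E = E} {A} {B} {C} (f , A-C) (g , B-C) = (λ y → f y - g y) , λ x → begin
  A x - B x                         ≡⟨ difference (A x) (B x) (C x) ⟩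
  (A x - C x) - (B x - C x)         ≡⟨ cong₂ _-_ (A-C x) (B-C x) ⟩
  LapApply E f x - LapApply E g x   ≡⟨ LapApply-- E f g x ⟨
  LapApply E (λ y → f y - g y) x    ∎
  where
  open ≡-Reasoning
  difference : ∀ (a b c : ℤ) → a - b ≡ (a - c) - (b - c)
  difference = solve-∀

∼-sub : ∀ {n} {E : Edges n} {A B : Divisor n} (C : Divisor n) → A ∼[ E ] B → (A -D C) ∼[ E ] (B -D C)
∼-sub {A = A} {B} C (f , A-B) = f , λ x → trans (cancel (A x) (B x) (C x)) (A-B x)
  where
  cancel : ∀ (a b c : ℤ) → (a - c) - (b - c) ≡ a - b
  cancel = solve-∀

∼-add : ∀ {n} {E : Edges n} {A B : Divisor n} (C : Divisor n) → A ∼[ E ] (B -D C) → (A +D C) ∼[ E ] B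
∼-add {A = A} {B} C (f , A-B+C) = f , λ x → trans (shift (A x) (B x) (C x)) (A-B+C x)
  where
  shift : ∀ (a b c : ℤ) → (a + c) - b ≡ a - (b - c)
  shift = solve-∀

deg-∼ : ∀ {n} {E : Edges n} → Loopless E → ∀ {A B : Divisor n} → A ∼[ E ] B → deg A ≡ deg B
deg-∼ {n} {E} loopless {A} {B} (f , A-B) = ℤₚ.i-j≡0⇒i≡j (deg A) (deg B) (begin
  deg A - deg B             ≡⟨ Σ-- n A B ⟨
  ΣFin n (λ x → A x - B x)  ≡⟨ Σ-cong n A-B ⟩
  deg (LapApply E f)        ≡⟨ deg-principal loopless f ⟩
  0ℤ                        ∎)
  where open ≡-Reasoning

Joins : ∀ {n} → Fin n × Fin n → Fin n → Fin n → Set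
Joins e x z = (proj₁ e ≡ x × proj₂ e ≡ z) ⊎ (proj₁ e ≡ z × proj₂ e ≡ x)

EdgeBetween : ∀ {n} → Edges n → Fin n → Fin n → Set
EdgeBetween {n} E x z = Σ (Fin n × Fin n) λ e → e ∈ E × Joins e x z

edge-there : ∀ {n} {E : Edges n} {e₀ x z} → EdgeBetween E x z → EdgeBetween (e₀ ∷ E) x z
edge-there (e , e∈E , joins) = e , there e∈E , joins

adjacent-edge : ∀ {n} (E : Edges n) {x z : Fin n} → Adjacent E x z → EdgeBetween E x z
adjacent-edge ((a , b) ∷ E) {x} {z} adj with a ≟ x | b ≟ z | a ≟ z | b ≟ x
... | yes a≡x | yes b≡z | _       | _       = (a , b) , here refl , inj₁ (a≡x , b≡z)
... | yes _   | no _    | yes a≡z | yes b≡x = (a , b) , here refl , inj₂ (a≡z , b≡x)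
... | no _    | _       | yes a≡z | yes b≡x = (a , b) , here refl , inj₂ (a≡z , b≡x)
... | yes _   | no _    | yes _   | no _    = edge-there (adjacent-edge E adj)
... | yes _   | no _    | no _    | _       = edge-there (adjacent-edge E adj)
... | no _    | _       | yes _   | no _    = edge-there (adjacent-edge E adj)
... | no _    | _       | no _    | _       = edge-there (adjacent-edge E adj)

module Cut {n} {P : Fin n → Set} (P? : ∀ x → Dec (P x)) where

  exactlyOne : ∀ {A B : Set} → Dec A → Dec B → ℕ
  exactlyOne (yes _) (yes _) = 0
  exactlyOne (yes _) (no _)  = 1
  exactlyOne (no _)  (yes _) = 1
  exactlyOne (no _)  (no _)  = 0

  exactlyOne≤1 : ∀ {A B : Set} (A? : Dec A) (B? : Dec B) → exactlyOne A? B? ℕ.≤ 1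
  exactlyOne≤1 (yes _) (yes _) = ℕ.z≤n
  exactlyOne≤1 (yes _) (no _)  = ℕ.s≤s ℕ.z≤n
  exactlyOne≤1 (no _)  (yes _) = ℕ.s≤s ℕ.z≤n
  exactlyOne≤1 (no _)  (no _)  = ℕ.z≤n

  crosses : Fin n → Fin n → ℕ
  crosses a b = exactlyOne (P? a) (P? b)

  indicator : Fin n → ℤ
  indicator x = if does (P? x) then 1ℤ else 0ℤ

  indicator-bound : ∀ x {a b : ℤ} → 0ℤ ≤ a → 0ℤ ≤ b → indicator x * (a - b) ≤ a
  indicator-bound x {a} {b} 0≤a 0≤b with does (P? x)
  ... | false = 0≤a
  ... | true = begin
    1ℤ * (a - b)  ≡⟨ ℤₚ.*-identityˡ (a - b) ⟩
    a - b         ≤⟨ ℤₚ.+-monoʳ-≤ a (ℤₚ.neg-mono-≤ 0≤b) ⟩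
    a + 0ℤ        ≡⟨ ℤₚ.+-identityʳ a ⟩
    a             ∎
    where open ℤₚ.≤-Reasoning

  cutSize : Edges n → ℕ
  cutSize [] = 0
  cutSize ((a , b) ∷ E) = crosses a b ℕ.+ cutSize E

  delete-cut-edge : ∀ (E : Edges n) {k} → cutSize E ≡ suc k →
    Σ (Fin (length E)) λ i → cutSize (removeAt E i) ≡ k
  delete-cut-edge ((a , b) ∷ E) size with crosses a b in crossing | exactlyOne≤1 (P? a) (P? b)
  ... | 0 | _ =
    let (i , size′) = delete-cut-edge E size
    in Fin.suc i , trans (cong (ℕ._+ cutSize (removeAt E i)) crossing) size′
  ... | 1 | _ = Fin.zero , ℕₚ.suc-injective size
  ... | suc (suc _) | ℕ.s≤s ()

  uncut-edge : ∀ (E : Edges n) → cutSize E ≡ 0 → ∀ {a b} → (a , b) ∈ E → (P a → P b) × (P b → P a)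
  uncut-edge ((a , b) ∷ E) size (here refl) with P? a | P? b
  ... | yes pa | yes pb = (λ _ → pb) , (λ _ → pa)
  ... | no ¬pa | no ¬pb = (λ pa → ⊥-elim (¬pa pa)) , (λ pb → ⊥-elim (¬pb pb))
  uncut-edge ((a , b) ∷ E) size (there e∈E) = uncut-edge E (ℕₚ.m+n≡0⇒n≡0 (crosses a b) size) e∈E

  uncut-closed : ∀ (E : Edges n) → cutSize E ≡ 0 → ∀ {x y} → Reachable E x y → P x → P y
  uncut-closed E size here px = px
  uncut-closed E size (step adj path) px with adjacent-edge E adj
  ... | _ , e∈E , inj₁ (refl , refl) = uncut-closed E size path (proj₁ (uncut-edge E size e∈E) px)
  ... | _ , e∈E , inj₂ (refl , refl) = uncut-closed E size path (proj₂ (uncut-edge E size e∈E) px)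

  small-cut : ∀ {E : Edges n} → ThreeEdgeConnected E → cutSize E ℕ.≤ 2 → ∀ {x} → P x → ∀ y → P y
  small-cut {E} (conn₀ , conn₁ , conn₂) small {x} px y with cutSize E in size | small
  ... | 0 | _ = uncut-closed E size (conn₀ x y) px
  ... | 1 | _ =
    let (i , size₁) = delete-cut-edge E size
    in uncut-closed _ size₁ (conn₁ i x y) px
  ... | 2 | _ =
    let (i , size₁) = delete-cut-edge E size
        (j , size₂) = delete-cut-edge (removeAt E i) size₁
    in uncut-closed _ size₂ (conn₂ i j x y) px
  ... | suc (suc (suc _)) | ℕ.s≤s (ℕ.s≤s ())

gap : ∀ {a b : ℤ} → b < a → 1ℤ ≤ a - b
gap {a} {b} b<a = ℤₚ.≤-trans (ℤₚ.≤-reflexive (one b)) (ℤₚ.+-monoˡ-≤ (- b) (ℤₚ.i<j⇒suc[i]≤j b<a))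
  where
  one : ∀ (b : ℤ) → 1ℤ ≡ (1ℤ + b) - b
  one = solve-∀

module TopLevel {n} (f : Fin n → ℤ) (M : ℤ) (isMax : ∀ y → f y ≤ M) where
  open Cut (λ y → f y ℤ.≟ M) public

  -- Each edge leaving the top level set has f-increment at least one.
  crossing-energy : ∀ a b → + crosses a b ≤ (indicator a - indicator b) * (f a - f b)
  crossing-energy a b with f a ℤ.≟ M | f b ℤ.≟ M
  ... | yes _ | yes _ = ℤₚ.≤-refl
  ... | no _ | no _ = ℤₚ.≤-refl
  ... | yes fa≡M | no fb≢M = begin
    1ℤ                    ≤⟨ gap (subst (f b <_) (sym fa≡M) (ℤₚ.≤∧≢⇒< (isMax b) fb≢M)) ⟩
    f a - f b             ≡⟨ ℤₚ.*-identityˡ (f a - f b) ⟨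
    1ℤ * (f a - f b)      ∎
    where open ℤₚ.≤-Reasoning
  ... | no fa≢M | yes fb≡M = begin
    1ℤ                    ≤⟨ gap (subst (f a <_) (sym fb≡M) (ℤₚ.≤∧≢⇒< (isMax a) fa≢M)) ⟩
    f b - f a             ≡⟨ flip (f a) (f b) ⟨
    -1ℤ * (f a - f b)     ∎
    where
    open ℤₚ.≤-Reasoning
    flip : ∀ (p q : ℤ) → -1ℤ * (p - q) ≡ q - p
    flip = solve-∀

  cut-energy : ∀ (E : Edges n) → + cutSize E ≤ energy E indicator f
  cut-energy [] = ℤₚ.≤-refl
  cut-energy ((a , b) ∷ E) = ℤₚ.+-mono-≤ (crossing-energy a b) (cut-energy E)

  cut-bound : ∀ {E : Edges n} {A B : Divisor n} → Loopless E → Effective A → Effective B →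
    (∀ x → A x - B x ≡ LapApply E f x) → + cutSize E ≤ deg A
  cut-bound {E} {A} {B} loopless effA effB A-B = begin
    + cutSize E                                 ≤⟨ cut-energy E ⟩
    energy E indicator f                        ≡⟨ summation-by-parts E indicator f ⟨
    ΣFin n (λ x → indicator x * edgeLap E f x)  ≡⟨ Σ-cong n (λ x → cong (indicator x *_) (Δf≡A-B x)) ⟩
    ΣFin n (λ x → indicator x * (A x - B x))    ≤⟨ Σ-mono n (λ x → indicator-bound x (effA x) (effB x)) ⟩
    deg A                                       ∎
    where
    open ℤₚ.≤-Reasoning
    Δf≡A-B : ∀ x → edgeLap E f x ≡ A x - B x
    Δf≡A-B x = sym (trans (A-B x) (LapApply≡edgeLap loopless f x))

maximum : ∀ {m} (f : Fin (suc m) → ℤ) → Σ (Fin (suc m)) λ x₀ → ∀ y → f y ≤ f x₀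
maximum {m} f = argmax f Fin.zero (allFin (suc m))
              , λ y → All.lookup (f[xs]≤f[argmax] {f = f} Fin.zero (allFin (suc m))) (∈-allFin y)

-- If A - B = Δ f, the top level set of f has at most deg A ≤ 2 edges leaving it, so by
-- 3-edge-connectivity it is everything; thus f is constant and A = B.
rigid : ∀ {n} {E : Edges n} {A B : Divisor n} → Loopless E → ThreeEdgeConnected E →
  Effective A → Effective B → deg A ≤ + 2 → A ∼[ E ] B → ∀ x → A x ≡ B x
rigid {zero} _ _ _ _ _ _ ()
rigid {suc m} {E} {A} {B} loopless 3ec effA effB degA≤2 (f , A-B) x =
  ℤₚ.i-j≡0⇒i≡j (A x) (B x) (begin
    A x - B x       ≡⟨ A-B x ⟩
    LapApply E f x  ≡⟨ LapApply≡edgeLap loopless f x ⟩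
    edgeLap E f x   ≡⟨ edgeLap-const E f-constant x ⟩
    0ℤ              ∎)
  where
  open ≡-Reasoning
  x₀ : Fin (suc m)
  x₀ = proj₁ (maximum f)
  open TopLevel f (f x₀) (proj₂ (maximum f))
  f-constant : ∀ y → f y ≡ f x₀
  f-constant = small-cut 3ec (ℤₚ.drop‿+≤+ (ℤₚ.≤-trans (cut-bound loopless effA effB A-B) degA≤2)) refl

-- On a loopless 3-edge-connected graph, an effective divisor of degree at most 3 is
-- determined by its linear equivalence class together with any one point of its support:
-- removing that point from two such divisors leaves equivalent effective divisors of degree
-- at most 2, which coincide by rigidity.
unique-through-point : ∀ {n} {E : Edges n} {D₁ D₂ : Divisor n} → Loopless E → ThreeEdgeConnected E →
  Effective D₁ → Effective D₂ → deg D₁ ≤ + 3 → D₁ ∼[ E ] D₂ →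
  ∀ {v} → + 0 < D₁ v → + 0 < D₂ v → ∀ w → D₁ w ≡ D₂ w
unique-through-point {D₁ = D₁} {D₂} loopless 3ec eff₁ eff₂ deg≤3 D₁∼D₂ {v} 0<D₁v 0<D₂v w =
  begin
    D₁ w                    ≡⟨ restore (D₁ w) (δ v w) ⟩
    (D₁ w - δ v w) + δ v w  ≡⟨ cong (_+ δ v w) (rigid loopless 3ec (remove-point eff₁ 0<D₁v)
                                 (remove-point eff₂ 0<D₂v) deg≤2 (∼-sub {A = D₁} {B = D₂} (δ v) D₁∼D₂) w) ⟩
    (D₂ w - δ v w) + δ v w  ≡⟨ restore (D₂ w) (δ v w) ⟨
    D₂ w                    ∎
  where
  open ≡-Reasoning
  restore : ∀ (a d : ℤ) → a ≡ (a - d) + d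
  restore = solve-∀
  deg≤2 : deg (D₁ -D δ v) ≤ + 2
  deg≤2 = ℤₚ.≤-trans (ℤₚ.≤-reflexive (deg-minus-point D₁ v)) (ℤₚ.+-monoˡ-≤ -1ℤ deg≤3)

lemma3p3 : (n : ℕ) (E : Edges n) → Loopless E → Simple E → ThreeEdgeConnected E →
    GonEq E 3 → (D : Divisor n) → RankEq E D 1 → deg D ≡ + 3 →
    (v : Fin n) →
      Σ (Divisor n) (λ D' → (Effective D' × (D' ∼[ E ] D) × (+ 0 < D' v))
        × ((D'' : Divisor n) → Effective D'' → D'' ∼[ E ] D → + 0 < D'' v →
             (w : Fin n) → D'' w ≡ D' w))
lemma3p3 n E loopless _ 3ec _ D (rank≥1 , _) degD≡3 v =
  D' , (D'-effective , D'∼D , add-point D₀-effective v) , unique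
  where
  -- r(D) ≥ 1, applied to F = (v), gives an effective D₀ ∼ D - (v); then D' = D₀ + (v).
  D₀-spec : Σ (Divisor n) λ D₀ → Effective D₀ × D₀ ∼[ E ] (D -D δ v)
  D₀-spec = rank≥1 (δ v) (δ-effective v) (deg-δ v)
  D₀ : Divisor n
  D₀ = proj₁ D₀-spec
  D₀-effective : Effective D₀
  D₀-effective = proj₁ (proj₂ D₀-spec)
  D' : Divisor n
  D' = D₀ +D δ v
  D'-effective : Effective D'
  D'-effective w = ℤₚ.+-mono-≤ (D₀-effective w) (δ-effective v w)
  D'∼D : D' ∼[ E ] D
  D'∼D = ∼-add {A = D₀} {B = D} (δ v) (proj₂ (proj₂ D₀-spec))
  unique : (D'' : Divisor n) → Effective D'' → D'' ∼[ E ] D → + 0 < D'' v → ∀ w → D'' w ≡ D' w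
  unique D'' D''-effective D''∼D 0<D''v =
    unique-through-point loopless 3ec D''-effective D'-effective
      (ℤₚ.≤-reflexive (trans (deg-∼ loopless D''∼D) degD≡3))
      (∼-common {A = D''} {B = D'} {C = D} D''∼D D'∼D) 0<D''v (add-point D₀-effective v)
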